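{- For every integer $n \geq 0$, $$\sum_{0 \leq j \leq n} 3^j\binom{3n-j}{2n} = \sum_{0 \leq j \leq n} 2^j\binom{3n+1}{n-j} = \sum_{0 \leq j \leq 2n} (-4)^j\binom{3n+1}{n+1+j} = \sum_{0 \leq j \leq 2n} (-3)^j\binom{3n-j}{n}.$$ -}

module Defs where

open import Data.Nat using (ℕ; zero; suc)
open import Data.Integer using (ℤ; _+_)

sumTo : ℕ → (ℕ → ℤ) → ℤ
sumTo zero    f = f zero
sumTo (suc n) f = sumTo n f + f (suc n)

-- Write  P(N,t,m) = Σ_{k ≤ m} C(N,k) t^(m-k)  for the first m+1 entries of
-- row N of Pascal's triangle, reversed and evaluated at t (Horner's scheme).
-- Every sum of the theorem is such a polynomial:
--   * reversing the summation index turns Σ 2^j C(3n+1,n-j) into P(3n+1,2,n)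
--     and, after the symmetry C(N,k) = C(N,N-k), Σ (-4)^j C(3n+1,n+1+j) into
--     P(3n+1,-4,2n);
--   * the diagonal identity  Σ_{k ≤ m} C(r+k,r) (t+1)^(m-k) = P(r+m+1,t,m),
--     proved from Pascal's rule for P, turns the sums weighted by 3^j and
--     (-3)^j into P(3n+1,2,n) and P(3n+1,-4,2n) respectively.
-- It remains to compare A n = P(3n+1,2,n) with B n = P(3n+1,-4,2n).  Pascal's
-- rule applied three times expresses P(N+3,t,m+3) through P(N,t,m); at t = 2
-- and t = -4 this yields recurrences  4 X(n+1) = 27 X(n) + (boundary terms)
-- for X = A, B.  The boundary terms coincide because in row N = 3n+1 the
-- successive-ratio formula gives C(N,n+1) = C(N,n) + 2 C(N,n-1), so A = B by
-- induction from the cases n = 0, 1, 2.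
module Submission where

open import Defs
open import Data.Nat using (ℕ; zero; suc; _∸_; _≤_; z≤n) renaming (_+_ to _+ℕ_; _*_ to _*ℕ_)
import Data.Nat.Properties as ℕ
import Data.Nat.Tactic.RingSolver as ℕ-Ring
open import Data.Nat.Combinatorics using (_C_; nCk≡nC[n∸k]; nCk+nC[k+1]≡[n+1]C[k+1]; nCn≡1; nC1≡n)
open import Data.Integer using (ℤ; +_; -_; _+_; _-_; _*_; _^_; 1ℤ)
import Data.Integer.Properties as ℤ
open import Data.Integer.Tactic.RingSolver using (solve-∀)
open import Data.List using (_∷_; [])
open import Data.Product using (_×_; _,_)
open import Relation.Binary.PropositionalEquality
  using (_≡_; refl; sym; trans; cong; cong₂; module ≡-Reasoning)

open ≡-Reasoning

sumTo-cong : ∀ m {f g : ℕ → ℤ} → (∀ j → j ≤ m → f j ≡ g j) → sumTo m f ≡ sumTo m g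
sumTo-cong zero    f≗g = f≗g 0 z≤n
sumTo-cong (suc m) f≗g =
  cong₂ _+_ (sumTo-cong m (λ j j≤m → f≗g j (ℕ.m≤n⇒m≤1+n j≤m))) (f≗g (suc m) ℕ.≤-refl)

sumTo-suc : ∀ m (f : ℕ → ℤ) → sumTo (suc m) f ≡ f 0 + sumTo m (λ j → f (suc j))
sumTo-suc zero    f = refl
sumTo-suc (suc m) f =
  trans (cong (_+ f (suc (suc m))) (sumTo-suc m f)) (ℤ.+-assoc (f 0) _ _)

sumTo-scale : ∀ m t (f : ℕ → ℤ) → sumTo m (λ j → t * f j) ≡ t * sumTo m f
sumTo-scale zero    t f = refl
sumTo-scale (suc m) t f =
  trans (cong (_+ t * f (suc m)) (sumTo-scale m t f)) (sym (ℤ.*-distribˡ-+ t _ _))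

horner : (ℕ → ℤ) → ℤ → ℕ → ℤ
horner c t zero    = c 0
horner c t (suc m) = t * horner c t m + c (suc m)

sum-reversed≡horner : ∀ c t m → sumTo m (λ j → t ^ j * c (m ∸ j)) ≡ horner c t m
sum-reversed≡horner c t zero    = ℤ.*-identityˡ (c 0)
sum-reversed≡horner c t (suc m) = begin
  sumTo (suc m) (λ j → t ^ j * c (suc m ∸ j))
    ≡⟨ sumTo-suc m (λ j → t ^ j * c (suc m ∸ j)) ⟩
  1ℤ * c (suc m) + sumTo m (λ j → (t * t ^ j) * c (m ∸ j))
    ≡⟨ cong₂ _+_ (ℤ.*-identityˡ (c (suc m)))
         (sumTo-cong m (λ j _ → ℤ.*-assoc t (t ^ j) (c (m ∸ j)))) ⟩
  c (suc m) + sumTo m (λ j → t * (t ^ j * c (m ∸ j)))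
    ≡⟨ cong (λ s → c (suc m) + s) (sumTo-scale m t (λ j → t ^ j * c (m ∸ j))) ⟩
  c (suc m) + t * sumTo m (λ j → t ^ j * c (m ∸ j))
    ≡⟨ ℤ.+-comm (c (suc m)) _ ⟩
  t * sumTo m (λ j → t ^ j * c (m ∸ j)) + c (suc m)
    ≡⟨ cong (λ s → t * s + c (suc m)) (sum-reversed≡horner c t m) ⟩
  horner c t (suc m) ∎

binomPoly : ℕ → ℤ → ℕ → ℤ
binomPoly N = horner (λ k → + (N C k))

pascalℤ : ∀ N k → + (suc N C suc k) ≡ + (N C k) + + (N C suc k)
pascalℤ N k = trans (cong +_ (sym (nCk+nC[k+1]≡[n+1]C[k+1] N k))) (ℤ.pos-+ (N C k) (N C suc k))

binomPoly-pascal : ∀ N t m → binomPoly (suc N) t (suc m) ≡ binomPoly N t (suc m) + binomPoly N t m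
binomPoly-pascal N t zero = begin
  t * + 1 + + (suc N C 1)        ≡⟨ cong (λ x → t * + 1 + x) (pascalℤ N 0) ⟩
  t * + 1 + (+ 1 + + (N C 1))    ≡⟨ regroup t (+ (N C 1)) ⟩
  (t * + 1 + + (N C 1)) + + 1    ∎
  where
  regroup : ∀ t c → t * + 1 + (+ 1 + c) ≡ (t * + 1 + c) + + 1
  regroup = solve-∀
binomPoly-pascal N t (suc m) = begin
  t * binomPoly (suc N) t (suc m) + + (suc N C suc (suc m))
    ≡⟨ cong₂ (λ p c → t * p + c) (binomPoly-pascal N t m) (pascalℤ N (suc m)) ⟩
  t * (binomPoly N t (suc m) + binomPoly N t m) + (+ (N C suc m) + + (N C suc (suc m)))
    ≡⟨ regroup t (binomPoly N t m) (+ (N C suc m)) (+ (N C suc (suc m))) ⟩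
  binomPoly N t (suc (suc m)) + binomPoly N t (suc m) ∎
  where
  regroup : ∀ t p c₁ c₂ → t * ((t * p + c₁) + p) + (c₁ + c₂) ≡ (t * (t * p + c₁) + c₂) + (t * p + c₁)
  regroup = solve-∀

binom-sym : ∀ {N} a b → N ≡ a +ℕ b → N C a ≡ N C b
binom-sym a b refl = trans (nCk≡nC[n∸k] (ℕ.m≤m+n a b)) (cong ((a +ℕ b) C_) (ℕ.m+n∸m≡n a b))

binomPoly-diagonal : ∀ t r m → horner (λ k → + ((r +ℕ k) C r)) (t + 1ℤ) m ≡ binomPoly (suc (r +ℕ m)) t m
binomPoly-diagonal t r zero = cong +_ (trans (cong (_C r) (ℕ.+-identityʳ r)) (nCn≡1 r))
binomPoly-diagonal t r (suc m) = begin
  (t + 1ℤ) * horner (λ k → + ((r +ℕ k) C r)) (t + 1ℤ) m + + ((r +ℕ suc m) C r)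
    ≡⟨ cong₂ (λ p c → (t + 1ℤ) * p + + c) (binomPoly-diagonal t r m) (trans (binom-sym r (suc m) refl) (cong (_C suc m) (ℕ.+-suc r m))) ⟩
  (t + 1ℤ) * binomPoly M t m + + (M C suc m)
    ≡⟨ regroup t (binomPoly M t m) (+ (M C suc m)) ⟩
  binomPoly M t (suc m) + binomPoly M t m
    ≡⟨ binomPoly-pascal M t m ⟨
  binomPoly (suc M) t (suc m)
    ≡⟨ cong (λ X → binomPoly (suc X) t (suc m)) (ℕ.+-suc r m) ⟨
  binomPoly (suc (r +ℕ suc m)) t (suc m) ∎
  where
  M = suc (r +ℕ m)
  regroup : ∀ t p c → (t + 1ℤ) * p + c ≡ (t * p + c) + p
  regroup = solve-∀

binomPoly-pascal³ : ∀ N t m →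
  binomPoly (3 +ℕ N) t (3 +ℕ m) ≡
    (t + 1ℤ) * (t + 1ℤ) * (t + 1ℤ) * binomPoly N t m + (t * t + + 3 * t + + 3) * + (N C (1 +ℕ m))
      + (t + + 3) * + (N C (2 +ℕ m)) + + (N C (3 +ℕ m))
binomPoly-pascal³ N t m = begin
  binomPoly (3 +ℕ N) t (3 +ℕ m)
    ≡⟨ binomPoly-pascal (2 +ℕ N) t (2 +ℕ m) ⟩
  binomPoly (2 +ℕ N) t (3 +ℕ m) + binomPoly (2 +ℕ N) t (2 +ℕ m)
    ≡⟨ cong₂ _+_ (trans (binomPoly-pascal (1 +ℕ N) t (2 +ℕ m))
                        (cong₂ _+_ (binomPoly-pascal N t (2 +ℕ m)) (binomPoly-pascal N t (1 +ℕ m))))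
                 (trans (binomPoly-pascal (1 +ℕ N) t (1 +ℕ m))
                        (cong₂ _+_ (binomPoly-pascal N t (1 +ℕ m)) (binomPoly-pascal N t m))) ⟩
  ((P 3 + P 2) + (P 2 + P 1)) + ((P 2 + P 1) + (P 1 + P 0))
    ≡⟨ cube-coefficients (P 3) (P 2) (P 1) (P 0) ⟩
  P 3 + + 3 * P 2 + + 3 * P 1 + P 0
    ≡⟨ unfold-horner t (P 0) (+ (N C (1 +ℕ m))) (+ (N C (2 +ℕ m))) (+ (N C (3 +ℕ m))) ⟩
  (t + 1ℤ) * (t + 1ℤ) * (t + 1ℤ) * P 0 + (t * t + + 3 * t + + 3) * + (N C (1 +ℕ m))
      + (t + + 3) * + (N C (2 +ℕ m)) + + (N C (3 +ℕ m)) ∎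
  where
  P : ℕ → ℤ
  P i = binomPoly N t (i +ℕ m)
  cube-coefficients : ∀ a b c d → ((a + b) + (b + c)) + ((b + c) + (c + d)) ≡ a + + 3 * b + + 3 * c + d
  cube-coefficients = solve-∀
  unfold-horner : ∀ t p c₁ c₂ c₃ →
    (t * (t * (t * p + c₁) + c₂) + c₃) + + 3 * (t * (t * p + c₁) + c₂) + + 3 * (t * p + c₁) + p
      ≡ (t + 1ℤ) * (t + 1ℤ) * (t + 1ℤ) * p + (t * t + + 3 * t + + 3) * c₁ + (t + + 3) * c₂ + c₃
  unfold-horner = solve-∀

diagonal-sum : ∀ t r m → sumTo m (λ j → (t + 1ℤ) ^ j * + ((r +ℕ m ∸ j) C r)) ≡ binomPoly (suc (r +ℕ m)) t m
diagonal-sum t r m = begin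
  sumTo m (λ j → (t + 1ℤ) ^ j * + ((r +ℕ m ∸ j) C r))
    ≡⟨ sumTo-cong m (λ j j≤m → cong (λ i → (t + 1ℤ) ^ j * + (i C r)) (ℕ.+-∸-assoc r j≤m)) ⟩
  sumTo m (λ j → (t + 1ℤ) ^ j * + ((r +ℕ (m ∸ j)) C r))
    ≡⟨ sum-reversed≡horner (λ k → + ((r +ℕ k) C r)) (t + 1ℤ) m ⟩
  horner (λ k → + ((r +ℕ k) C r)) (t + 1ℤ) m
    ≡⟨ binomPoly-diagonal t r m ⟩
  binomPoly (suc (r +ℕ m)) t m ∎

reflected-row-sum : ∀ t a b → sumTo b (λ j → t ^ j * + ((a +ℕ b) C (a +ℕ j))) ≡ binomPoly (a +ℕ b) t b
reflected-row-sum t a b =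
  trans (sumTo-cong b (λ j j≤b → cong (λ x → t ^ j * + x) (reflect j j≤b)))
        (sum-reversed≡horner (λ k → + ((a +ℕ b) C k)) t b)
  where
  reflect : ∀ j → j ≤ b → (a +ℕ b) C (a +ℕ j) ≡ (a +ℕ b) C (b ∸ j)
  reflect j j≤b = trans (nCk≡nC[n∸k] (ℕ.+-monoʳ-≤ a j≤b)) (cong ((a +ℕ b) C_) (ℕ.[m+n]∸[m+o]≡n∸o a b j))

A B : ℕ → ℤ
A n = binomPoly (3 *ℕ n +ℕ 1) (+ 2) n
B n = binomPoly (3 *ℕ n +ℕ 1) (- (+ 4)) (2 *ℕ n)

sum₁≡A : ∀ n → sumTo n (λ j → (+ 3) ^ j * + ((3 *ℕ n ∸ j) C (2 *ℕ n))) ≡ A n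
sum₁≡A n = begin
  sumTo n (λ j → (+ 3) ^ j * + ((3 *ℕ n ∸ j) C (2 *ℕ n)))
    ≡⟨ cong (λ M → sumTo n (λ j → (+ 3) ^ j * + ((M ∸ j) C (2 *ℕ n)))) (ℕ-Ring.solve (n ∷ [])) ⟩
  sumTo n (λ j → (+ 2 + 1ℤ) ^ j * + ((2 *ℕ n +ℕ n ∸ j) C (2 *ℕ n)))
    ≡⟨ diagonal-sum (+ 2) (2 *ℕ n) n ⟩
  binomPoly (suc (2 *ℕ n +ℕ n)) (+ 2) n
    ≡⟨ cong (λ N → binomPoly N (+ 2) n) (ℕ-Ring.solve (n ∷ [])) ⟩
  A n ∎

sum₂≡A : ∀ n → sumTo n (λ j → (+ 2) ^ j * + ((3 *ℕ n +ℕ 1) C (n ∸ j))) ≡ A n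
sum₂≡A n = sum-reversed≡horner (λ k → + ((3 *ℕ n +ℕ 1) C k)) (+ 2) n

sum₃≡B : ∀ n → sumTo (2 *ℕ n) (λ j → (- (+ 4)) ^ j * + ((3 *ℕ n +ℕ 1) C (n +ℕ 1 +ℕ j))) ≡ B n
sum₃≡B n = begin
  sumTo (2 *ℕ n) (λ j → (- (+ 4)) ^ j * + ((3 *ℕ n +ℕ 1) C (n +ℕ 1 +ℕ j)))
    ≡⟨ cong (λ N → sumTo (2 *ℕ n) (λ j → (- (+ 4)) ^ j * + (N C (n +ℕ 1 +ℕ j)))) N≡ ⟩
  sumTo (2 *ℕ n) (λ j → (- (+ 4)) ^ j * + ((n +ℕ 1 +ℕ 2 *ℕ n) C (n +ℕ 1 +ℕ j)))
    ≡⟨ reflected-row-sum (- (+ 4)) (n +ℕ 1) (2 *ℕ n) ⟩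
  binomPoly (n +ℕ 1 +ℕ 2 *ℕ n) (- (+ 4)) (2 *ℕ n)
    ≡⟨ cong (λ N → binomPoly N (- (+ 4)) (2 *ℕ n)) N≡ ⟨
  B n ∎
  where
  N≡ : 3 *ℕ n +ℕ 1 ≡ n +ℕ 1 +ℕ 2 *ℕ n
  N≡ = ℕ-Ring.solve (n ∷ [])

sum₄≡B : ∀ n → sumTo (2 *ℕ n) (λ j → (- (+ 3)) ^ j * + ((3 *ℕ n ∸ j) C n)) ≡ B n
sum₄≡B n = begin
  sumTo (2 *ℕ n) (λ j → (- (+ 3)) ^ j * + ((3 *ℕ n ∸ j) C n))
    ≡⟨ cong (λ M → sumTo (2 *ℕ n) (λ j → (- (+ 3)) ^ j * + ((M ∸ j) C n))) (ℕ-Ring.solve (n ∷ [])) ⟩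
  sumTo (2 *ℕ n) (λ j → (- (+ 4) + 1ℤ) ^ j * + ((n +ℕ 2 *ℕ n ∸ j) C n))
    ≡⟨ diagonal-sum (- (+ 4)) n (2 *ℕ n) ⟩
  binomPoly (suc (n +ℕ 2 *ℕ n)) (- (+ 4)) (2 *ℕ n)
    ≡⟨ cong (λ N → binomPoly N (- (+ 4)) (2 *ℕ n)) (ℕ-Ring.solve (n ∷ [])) ⟩
  B n ∎

absorption : ∀ M k → suc k *ℕ (suc M C suc k) ≡ suc M *ℕ (M C k)
absorption zero    zero    = refl
absorption zero    (suc k) = ℕ.*-zeroʳ (2 +ℕ k)
absorption (suc M) zero    = trans (ℕ.+-identityʳ _) (trans (nC1≡n (2 +ℕ M)) (sym (ℕ.*-identityʳ (2 +ℕ M))))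
absorption (suc M) (suc k) = begin
  (2 +ℕ k) *ℕ ((2 +ℕ M) C (2 +ℕ k))
    ≡⟨ cong ((2 +ℕ k) *ℕ_) (nCk+nC[k+1]≡[n+1]C[k+1] (suc M) (suc k)) ⟨
  (2 +ℕ k) *ℕ (X +ℕ Y)
    ≡⟨ spread k X Y ⟩
  ((1 +ℕ k) *ℕ X +ℕ (2 +ℕ k) *ℕ Y) +ℕ X
    ≡⟨ cong (_+ℕ X) (cong₂ _+ℕ_ (absorption M k) (absorption M (suc k))) ⟩
  ((1 +ℕ M) *ℕ (M C k) +ℕ (1 +ℕ M) *ℕ (M C suc k)) +ℕ X
    ≡⟨ cong (_+ℕ X) (ℕ.*-distribˡ-+ (suc M) (M C k) (M C suc k)) ⟨
  (1 +ℕ M) *ℕ ((M C k) +ℕ (M C suc k)) +ℕ X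
    ≡⟨ cong (λ z → (1 +ℕ M) *ℕ z +ℕ X) (nCk+nC[k+1]≡[n+1]C[k+1] M k) ⟩
  (1 +ℕ M) *ℕ X +ℕ X
    ≡⟨ ℕ.+-comm ((1 +ℕ M) *ℕ X) X ⟩
  (2 +ℕ M) *ℕ X ∎
  where
  X = suc M C suc k
  Y = suc M C suc (suc k)
  spread : ∀ k x y → (2 +ℕ k) *ℕ (x +ℕ y) ≡ ((1 +ℕ k) *ℕ x +ℕ (2 +ℕ k) *ℕ y) +ℕ x
  spread = ℕ-Ring.solve-∀

successive-ratio : ∀ {N} j d → N ≡ j +ℕ suc d → suc j *ℕ (N C suc j) ≡ suc d *ℕ (N C j)
successive-ratio j d refl = begin
  suc j *ℕ ((j +ℕ suc d) C suc j)    ≡⟨ cong (λ x → suc j *ℕ (x C suc j)) (ℕ.+-suc j d) ⟩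
  suc j *ℕ (suc M C suc j)           ≡⟨ absorption M j ⟩
  suc M *ℕ (M C j)                   ≡⟨ cong (suc M *ℕ_) (binom-sym j d refl) ⟩
  suc M *ℕ (M C d)                   ≡⟨ absorption M d ⟨
  suc d *ℕ (suc M C suc d)           ≡⟨ cong (λ x → suc d *ℕ (x C suc d)) (ℕ.+-suc j d) ⟨
  suc d *ℕ ((j +ℕ suc d) C suc d)    ≡⟨ cong (suc d *ℕ_) (binom-sym j (suc d) refl) ⟨
  suc d *ℕ ((j +ℕ suc d) C j)        ∎
  where
  M = j +ℕ d

-- A (k+2) and B (k+2) live in row N = 3(k+2)+1; their recurrences involve the entries C(N, k+i).
rowₖ : ℕ → ℕ
rowₖ k = 3 *ℕ (2 +ℕ k) +ℕ 1

midₖ : ℕ → ℕ → ℕ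
midₖ k i = rowₖ k C (i +ℕ k)

rowₖ-suc : ∀ k → 3 *ℕ (3 +ℕ k) +ℕ 1 ≡ 3 +ℕ (3 *ℕ (2 +ℕ k) +ℕ 1)
rowₖ-suc k = ℕ-Ring.solve (k ∷ [])

-- In that row, C(N, k+3) = C(N, k+2) + 2 C(N, k+1): both sides times k+3 equal (2k+5) C(N, k+2).
mid-recurrence : ∀ k → midₖ k 3 ≡ midₖ k 2 +ℕ 2 *ℕ midₖ k 1
mid-recurrence k = ℕ.*-cancelˡ-≡ _ _ (3 +ℕ k) (begin
  (3 +ℕ k) *ℕ midₖ k 3
    ≡⟨ successive-ratio (2 +ℕ k) (2 *ℕ k +ℕ 4) row-split₂ ⟩
  suc (2 *ℕ k +ℕ 4) *ℕ midₖ k 2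
    ≡⟨ split k (midₖ k 2) ⟩
  (3 +ℕ k) *ℕ midₖ k 2 +ℕ (2 +ℕ k) *ℕ midₖ k 2
    ≡⟨ cong ((3 +ℕ k) *ℕ midₖ k 2 +ℕ_) (successive-ratio (1 +ℕ k) (2 *ℕ k +ℕ 5) row-split₁) ⟩
  (3 +ℕ k) *ℕ midₖ k 2 +ℕ suc (2 *ℕ k +ℕ 5) *ℕ midₖ k 1
    ≡⟨ collect k (midₖ k 1) (midₖ k 2) ⟩
  (3 +ℕ k) *ℕ (midₖ k 2 +ℕ 2 *ℕ midₖ k 1) ∎)
  where
  row-split₂ : 3 *ℕ (2 +ℕ k) +ℕ 1 ≡ (2 +ℕ k) +ℕ suc (2 *ℕ k +ℕ 4)
  row-split₂ = ℕ-Ring.solve (k ∷ [])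
  row-split₁ : 3 *ℕ (2 +ℕ k) +ℕ 1 ≡ (1 +ℕ k) +ℕ suc (2 *ℕ k +ℕ 5)
  row-split₁ = ℕ-Ring.solve (k ∷ [])
  split : ∀ k x → suc (2 *ℕ k +ℕ 4) *ℕ x ≡ (3 +ℕ k) *ℕ x +ℕ (2 +ℕ k) *ℕ x
  split = ℕ-Ring.solve-∀
  collect : ∀ k x y → (3 +ℕ k) *ℕ y +ℕ suc (2 *ℕ k +ℕ 5) *ℕ x ≡ (3 +ℕ k) *ℕ (y +ℕ 2 *ℕ x)
  collect = ℕ-Ring.solve-∀

A-recurrence : ∀ k →
  + 4 * A (3 +ℕ k) ≡ + 27 * A (2 +ℕ k) + (+ 4 * + midₖ k 3 - + 7 * + midₖ k 2 - + 2 * + midₖ k 1)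
A-recurrence k = begin
  + 4 * A (3 +ℕ k)
    ≡⟨ cong (λ N → + 4 * binomPoly N (+ 2) (3 +ℕ k)) (rowₖ-suc k) ⟩
  + 4 * binomPoly (3 +ℕ rowₖ k) (+ 2) (3 +ℕ k)
    ≡⟨ trans (cong (+ 4 *_) (binomPoly-pascal³ (rowₖ k) (+ 2) k))
             (collect (binomPoly (rowₖ k) (+ 2) k) (+ midₖ k 1) (+ midₖ k 2) (+ midₖ k 3)) ⟩
  + 27 * A (2 +ℕ k) + (+ 4 * + midₖ k 3 - + 7 * + midₖ k 2 - + 2 * + midₖ k 1) ∎
  where
  collect : ∀ p c₁ c₂ c₃ →
    + 4 * ((+ 2 + 1ℤ) * (+ 2 + 1ℤ) * (+ 2 + 1ℤ) * p + (+ 2 * + 2 + + 3 * + 2 + + 3) * c₁ + (+ 2 + + 3) * c₂ + c₃)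
      ≡ + 27 * (+ 2 * (+ 2 * p + c₁) + c₂) + (+ 4 * c₃ - + 7 * c₂ - + 2 * c₁)
  collect = solve-∀

-- At t = -4 the triple Pascal rule, followed by the symmetry C(N, 2k+3+i) = C(N, k+4-i),
-- gives  4 B(k+3) = 27 B(k+2) + boundary terms.
B-recurrence : ∀ k →
  + 4 * B (3 +ℕ k) ≡ + 27 * B (2 +ℕ k) + (+ 4 * + midₖ k 1 - + 4 * + midₖ k 2 + + midₖ k 3)
B-recurrence k = begin
  + 4 * B (3 +ℕ k)
    ≡⟨ cong₂ (λ N i → + 4 * binomPoly N (- (+ 4)) i) (rowₖ-suc k) 2[3+k]≡3+m ⟩
  + 4 * binomPoly (3 +ℕ rowₖ k) (- (+ 4)) (3 +ℕ m)
    ≡⟨ trans (cong (+ 4 *_) (binomPoly-pascal³ (rowₖ k) (- (+ 4)) m))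
             (collect (binomPoly (rowₖ k) (- (+ 4)) m) (+ far 1) (+ far 2) (+ far 3)) ⟩
  + 27 * binomPoly (rowₖ k) (- (+ 4)) (1 +ℕ m) + (+ 4 * + far 3 - + 4 * + far 2 + + far 1)
    ≡⟨ cong₂ (λ i δ → + 27 * binomPoly (rowₖ k) (- (+ 4)) i + δ) 1+m≡2[2+k] mirrored ⟩
  + 27 * B (2 +ℕ k) + (+ 4 * + midₖ k 1 - + 4 * + midₖ k 2 + + midₖ k 3) ∎
  where
  m = 2 *ℕ k +ℕ 3
  2[3+k]≡3+m : 2 *ℕ (3 +ℕ k) ≡ 3 +ℕ (2 *ℕ k +ℕ 3)
  2[3+k]≡3+m = ℕ-Ring.solve (k ∷ [])
  1+m≡2[2+k] : 1 +ℕ (2 *ℕ k +ℕ 3) ≡ 2 *ℕ (2 +ℕ k)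
  1+m≡2[2+k] = ℕ-Ring.solve (k ∷ [])
  far : ℕ → ℕ
  far i = rowₖ k C (i +ℕ m)
  mirror : ∀ i j → 3 *ℕ (2 +ℕ k) +ℕ 1 ≡ (i +ℕ (2 *ℕ k +ℕ 3)) +ℕ (j +ℕ k) → + far i ≡ + midₖ k j
  mirror i j N≡ = cong +_ (binom-sym {rowₖ k} (i +ℕ m) (j +ℕ k) N≡)
  mirrored : + 4 * + far 3 - + 4 * + far 2 + + far 1 ≡ + 4 * + midₖ k 1 - + 4 * + midₖ k 2 + + midₖ k 3
  mirrored = begin
    + 4 * + far 3 - + 4 * + far 2 + + far 1
      ≡⟨ cong₂ (λ x y → + 4 * x - + 4 * y + + far 1)
               (mirror 3 1 (ℕ-Ring.solve (k ∷ []))) (mirror 2 2 (ℕ-Ring.solve (k ∷ []))) ⟩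
    + 4 * + midₖ k 1 - + 4 * + midₖ k 2 + + far 1
      ≡⟨ cong (λ z → + 4 * + midₖ k 1 - + 4 * + midₖ k 2 + z) (mirror 1 3 (ℕ-Ring.solve (k ∷ []))) ⟩
    + 4 * + midₖ k 1 - + 4 * + midₖ k 2 + + midₖ k 3 ∎
  collect : ∀ p c₁ c₂ c₃ →
    + 4 * ((- (+ 4) + 1ℤ) * (- (+ 4) + 1ℤ) * (- (+ 4) + 1ℤ) * p
            + (- (+ 4) * - (+ 4) + + 3 * - (+ 4) + + 3) * c₁ + (- (+ 4) + + 3) * c₂ + c₃)
      ≡ + 27 * (- (+ 4) * p + c₁) + (+ 4 * c₃ - + 4 * c₂ + c₁)
  collect = solve-∀

boundaries-agree : ∀ k →
  + 4 * + midₖ k 3 - + 7 * + midₖ k 2 - + 2 * + midₖ k 1 ≡ + 4 * + midₖ k 1 - + 4 * + midₖ k 2 + + midₖ k 3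
boundaries-agree k = begin
  + 4 * c₃ - + 7 * c₂ - + 2 * c₁          ≡⟨ cong (λ x → + 4 * x - + 7 * c₂ - + 2 * c₁) c₃≡ ⟩
  + 4 * (c₂ + + 2 * c₁) - + 7 * c₂ - + 2 * c₁ ≡⟨ regroup c₁ c₂ ⟩
  + 4 * c₁ - + 4 * c₂ + (c₂ + + 2 * c₁)   ≡⟨ cong (λ x → + 4 * c₁ - + 4 * c₂ + x) c₃≡ ⟨
  + 4 * c₁ - + 4 * c₂ + c₃                ∎
  where
  c₁ = + midₖ k 1
  c₂ = + midₖ k 2
  c₃ = + midₖ k 3
  c₃≡ : c₃ ≡ c₂ + + 2 * c₁
  c₃≡ = trans (cong +_ (mid-recurrence k))
              (trans (ℤ.pos-+ (midₖ k 2) _) (cong (λ x → c₂ + x) (ℤ.pos-* 2 (midₖ k 1))))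
  regroup : ∀ c₁ c₂ → + 4 * (c₂ + + 2 * c₁) - + 7 * c₂ - + 2 * c₁ ≡ + 4 * c₁ - + 4 * c₂ + (c₂ + + 2 * c₁)
  regroup = solve-∀

A≡B : ∀ n → A n ≡ B n
A≡B 0 = refl
A≡B 1 = refl
A≡B 2 = refl
A≡B (suc (suc (suc k))) = ℤ.*-cancelˡ-≡ (+ 4) (A (3 +ℕ k)) (B (3 +ℕ k)) (begin
  + 4 * A (3 +ℕ k)
    ≡⟨ A-recurrence k ⟩
  + 27 * A (2 +ℕ k) + (+ 4 * + midₖ k 3 - + 7 * + midₖ k 2 - + 2 * + midₖ k 1)
    ≡⟨ cong₂ (λ x δ → + 27 * x + δ) (A≡B (suc (suc k))) (boundaries-agree k) ⟩
  + 27 * B (2 +ℕ k) + (+ 4 * + midₖ k 1 - + 4 * + midₖ k 2 + + midₖ k 3)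
    ≡⟨ B-recurrence k ⟨
  + 4 * B (3 +ℕ k) ∎)

theorem2 : (n : ℕ) →
    (sumTo n (λ j → (+ 3) ^ j * + ((3 *ℕ n ∸ j) C (2 *ℕ n)))
      ≡ sumTo n (λ j → (+ 2) ^ j * + ((3 *ℕ n +ℕ 1) C (n ∸ j))))
    × (sumTo n (λ j → (+ 2) ^ j * + ((3 *ℕ n +ℕ 1) C (n ∸ j)))
      ≡ sumTo (2 *ℕ n) (λ j → (- (+ 4)) ^ j * + ((3 *ℕ n +ℕ 1) C (n +ℕ 1 +ℕ j))))
    × (sumTo (2 *ℕ n) (λ j → (- (+ 4)) ^ j * + ((3 *ℕ n +ℕ 1) C (n +ℕ 1 +ℕ j)))
      ≡ sumTo (2 *ℕ n) (λ j → (- (+ 3)) ^ j * + ((3 *ℕ n ∸ j) C n)))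
theorem2 n =
  trans (sum₁≡A n) (sym (sum₂≡A n)) ,
  trans (sum₂≡A n) (trans (A≡B n) (sym (sum₃≡B n))) ,
  trans (sum₃≡B n) (sym (sum₄≡B n))
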